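{- For integers $p,d\ge 0$, let $T_{p,d}$ be the graph consisting of a vertex $v$, $p$ pendant vertices adjacent only to $v$, and $d$ triples of vertices $\{u_i,w_i,x_i\}$ ($1\le i\le d$) with edges $u_ix_i$, $w_ix_i$, $u_iv$, $w_iv$, properly two-colored ($v$ and all $x_i$ one color; the pendants and all $u_i,w_i$ the other color). The Sprague–Grundy value of the \textsc{flag coloring} position on $T_{p,d}$ is: (i) $0$ if $p=0$ (any $d\ge0$); (ii) if $d=0$: $\ast 1$ if $p$ is odd and $\ast 2$ if $p\ge 2$ is even; (iii) $0$ if $p\ge 2$ is even and $d\ge 1$; (iv) if $p$ is odd: $\ast 3$ if $d=1$; $\ast 1$ if $d\ge 2$ is even; $\ast 2$ if $d\ge 3$ is odd.
   Context: \textsc{flag coloring} is an impartial two-player game played on a simple graph whose vertices are colored. A move consists of choosing a vertex $v$, of color $c$ say, and a color $c'\neq c$ that is the color of some vertex adjacent to $v$; then $v$ and every vertex of the connected component of the subgraph induced by color-$c$ vertices that contains $v$ are recolored $c'$. Play is under the normal play convention: a player unable to move loses. Each position gets a Sprague–Grundy value (nimber) $\ast n$, where $n$ is the minimum non-negative integer not among the values of its options (positions with no options have value $0$); $\ast 1$ is also written $\ast$. -}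

module Defs where

open import Data.Nat using (ℕ; zero; suc; _<_)
open import Data.Fin using (Fin)
open import Data.Product using (Σ; ∃; _×_)
open import Relation.Nullary using (¬_)
open import Relation.Binary.PropositionalEquality using (_≡_; _≢_)

module FlagColoring (V : Set) (Adj : V → V → Set) where

  Coloring : Set
  Coloring = V → ℕ

  data MonoReach (col : Coloring) (v : V) : V → Set where
    here : MonoReach col v v
    step : ∀ {w y} → MonoReach col v w → Adj w y → col y ≡ col v →
           MonoReach col v y

  Move : Coloring → Coloring → Set
  Move col col' =
    Σ V λ v → Σ V λ u → Adj v u × col u ≢ col v ×
      (∀ w → (MonoReach col v w → col' w ≡ col u) ×
             (¬ MonoReach col v w → col' w ≡ col w))

  data Grundy (col : Coloring) (n : ℕ) : Set where
    grundy :
      (val : ∀ col' → Move col col' → ℕ) →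
      (∀ col' (m : Move col col') → Grundy col' (val col' m)) →
      (∀ k → k < n → Σ Coloring λ col' → Σ (Move col col') λ m → val col' m ≡ k) →
      (∀ col' (m : Move col col') → val col' m ≢ n) →
      Grundy col n

data TV (p d : ℕ) : Set where
  cv   : TV p d
  pend : Fin p → TV p d
  uu   : Fin d → TV p d
  ww   : Fin d → TV p d
  xx   : Fin d → TV p d

data TAdj {p d : ℕ} : TV p d → TV p d → Set where
  v-pend : ∀ j → TAdj cv (pend j)
  pend-v : ∀ j → TAdj (pend j) cv
  u-x    : ∀ i → TAdj (uu i) (xx i)
  x-u    : ∀ i → TAdj (xx i) (uu i)
  w-x    : ∀ i → TAdj (ww i) (xx i)
  x-w    : ∀ i → TAdj (xx i) (ww i)
  u-v    : ∀ i → TAdj (uu i) cv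
  v-u    : ∀ i → TAdj cv (uu i)
  w-v    : ∀ i → TAdj (ww i) cv
  v-w    : ∀ i → TAdj cv (ww i)

Tcol : (p d : ℕ) → TV p d → ℕ
Tcol p d cv       = 0
Tcol p d (pend _) = 1
Tcol p d (uu _)   = 1
Tcol p d (ww _)   = 1
Tcol p d (xx _)   = 0

TGrundy : (p d n : ℕ) → Set
TGrundy p d n = FlagColoring.Grundy (TV p d) TAdj (Tcol p d) n

{-# OPTIONS --safe #-}
module Submission where

-- Every position reachable on T_{p,d} is 2-coloured, and it is best read relative
-- to the colour of v. A pendant either joins the component of v or is a
-- component of its own; a triple u_i, w_i, x_i is absorbed into the component of
-- v, fresh (its initial pattern, three components off the centre) or single
-- (exactly one component off the centre). Recolouring a lone pendant or the
-- component of a single triple absorbs it, recolouring a component of a fresh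
-- triple makes it single, and recolouring the component of v absorbs all lone
-- pendants and single triples while every fresh triple becomes single. So with
-- s lone pendants and single triples and n fresh triples the game is the
-- counting game with moves (s+1, n) ↝ (s, n), (s, n+1) ↝ (s+1, n) and
-- (s, n) ↝ (n, 0) for s + n > 0, and a finite check of the mex equation gives
-- its values.

open import Defs
open import Algebra.Bundles using (CommutativeRing)
open import Data.Bool using (Bool; true; false; not; _∧_; _∨_; _xor_; if_then_else_)
open import Data.Bool.Properties using (xor-same; xor-∧-commutativeRing; not-injective; ¬-not)
open import Data.Empty using (⊥-elim)
open import Data.Fin using (Fin; zero; suc)
import Data.Fin.Properties as Fin
open import Data.Nat using (ℕ; zero; suc; _+_; _*_; _<_; z≤n; s≤s)
open import Data.Nat.Properties
  using ( n≮0; n<1+n; +-suc; +-comm; *-suc; +-identityʳ; +-monoˡ-≤; ≤-refl; ≤-trans; <-≤-trans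
        ; m≤m+n; m≤n+m; suc-injective)
open import Data.Product using (Σ; _×_; _,_; proj₁; proj₂; uncurry)
open import Data.Sum using (_⊎_; inj₁; inj₂)
open import Function using (_∘_)
open import Relation.Binary using (DecidableEquality)
open import Relation.Binary.PropositionalEquality
  using (_≡_; _≢_; refl; sym; trans; cong; cong₂; subst; module ≡-Reasoning)
open ≡-Reasoning
open import Relation.Nullary using (¬_; yes; no; does; contradiction)
open import Relation.Nullary.Decidable using (map′; _×-dec_; dec-true; dec-false)
open import Algebra.Properties.CommutativeSemigroup
  (CommutativeRing.+-commutativeSemigroup xor-∧-commutativeRing) using (interchange)

module _ {V : Set} {Adj : V → V → Set} where
  open FlagColoring V Adj

  monoReach-colour : ∀ {col v w} → MonoReach col v w → col w ≡ col v
  monoReach-colour here         = refl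
  monoReach-colour (step _ _ e) = e

  monoReach-trans : ∀ {col u v w} → MonoReach col u v → MonoReach col v w → MonoReach col u w
  monoReach-trans r here          = r
  monoReach-trans r (step r′ a e) = step (monoReach-trans r r′) a (trans e (monoReach-colour r))

  monoReach-sym : (∀ {a b} → Adj a b → Adj b a) →
                  ∀ {col v w} → MonoReach col v w → MonoReach col w v
  monoReach-sym adj-sym here         = here
  monoReach-sym adj-sym (step r a e) =
    monoReach-trans (step here (adj-sym a) (trans (monoReach-colour r) (sym e)))
                    (monoReach-sym adj-sym r)

  module Simulation
    {S : Set} (_↝_ : S → S → Set) (val size : S → ℕ)
    (↝-size : ∀ {s t} → s ↝ t → size t < size s)
    (val-↝-≢ : ∀ {s t} → s ↝ t → val t ≢ val s)
    (val-mex : ∀ s k → k < val s → Σ S λ t → s ↝ t × val t ≡ k)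
    (Abstracts : S → Coloring → Set)
    (abstracts-unique : ∀ {s t col} → Abstracts s col → Abstracts t col → s ≡ t)
    (forth : ∀ {s col col′} → Abstracts s col → Move col col′ → Σ S λ t → s ↝ t × Abstracts t col′)
    (back : ∀ {s t col} → Abstracts s col → s ↝ t →
            Σ Coloring λ col′ → Move col col′ × Abstracts t col′)
    where

    grundy-of-abstraction : ∀ {s col} → Abstracts s col → Grundy col (val s)
    grundy-of-abstraction = go _ ≤-refl
      where
      go : ∀ bound {s col} → size s < bound → Abstracts s col → Grundy col (val s)
      go (suc bound) {s} {col} (s≤s size≤bound) abs =
        grundy (λ _ m → val (target m))
               (λ _ m → go bound (<-≤-trans (↝-size (move-step m)) size≤bound) (abstracts m))
               cover
               (λ _ m → val-↝-≢ (move-step m))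
        where
        target : ∀ {col′} → Move col col′ → S
        target m = proj₁ (forth abs m)
        move-step : ∀ {col′} (m : Move col col′) → s ↝ target m
        move-step m = proj₁ (proj₂ (forth abs m))
        abstracts : ∀ {col′} (m : Move col col′) → Abstracts (target m) col′
        abstracts m = proj₂ (proj₂ (forth abs m))

        cover : ∀ k → k < val s → Σ Coloring λ col′ → Σ (Move col col′) λ m → val (target m) ≡ k
        cover k k< with val-mex s k k<
        ... | t , s↝t , val-t with back abs s↝t
        ...   | col′ , m , abs′ = col′ , m , trans (cong val (abstracts-unique (abstracts m) abs′)) val-t

isOdd : ℕ → Bool
isOdd zero    = false
isOdd (suc n) = not (isOdd n)

-- The clauses on the second argument come first, so that value s (suc n)
-- computes for a variable s.
value : ℕ → ℕ → ℕ
value s       (suc zero)    = if isOdd s then 3 else 0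
value s       (suc (suc n)) = if isOdd s then (if isOdd n then 2 else 1) else 0
value zero    zero          = 0
value (suc s) zero          = if isOdd s then 2 else 1

infix 4 _↝_

data _↝_ : ℕ × ℕ → ℕ × ℕ → Set where
  resolve  : ∀ {s n} → (suc s , n) ↝ (s , n)
  break    : ∀ {s n} → (s , suc n) ↝ (suc s , n)
  recentre : ∀ {s n} → 0 < s + n → (s , n) ↝ (n , 0)

weight : ℕ × ℕ → ℕ
weight (s , n) = s + n + n

↝-weight : ∀ {a b} → a ↝ b → weight b < weight a
↝-weight resolve                   = n<1+n _
↝-weight (break {s} {n})           rewrite +-suc s n | +-suc (s + n) n = n<1+n _
↝-weight (recentre {s} {n} 0<s+n) rewrite +-identityʳ n | +-identityʳ n = +-monoˡ-≤ n 0<s+n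

value-↝-≢ : ∀ {a b} → a ↝ b → uncurry value b ≢ uncurry value a
value-↝-≢ (resolve {zero}  {zero})        = λ ()
value-↝-≢ (resolve {suc s} {zero})        with isOdd s
... | true  = λ ()
... | false = λ ()
value-↝-≢ (resolve {s}     {suc zero})    with isOdd s
... | true  = λ ()
... | false = λ ()
value-↝-≢ (resolve {s}     {suc (suc n)}) with isOdd s | isOdd n
... | true  | true  = λ ()
... | true  | false = λ ()
... | false | true  = λ ()
... | false | false = λ ()
value-↝-≢ (break {s} {zero})              with isOdd s
... | true  = λ ()
... | false = λ ()
value-↝-≢ (break {s} {suc zero})          with isOdd s
... | true  = λ ()
... | false = λ ()
value-↝-≢ (break {s} {suc (suc n)})       with isOdd s | isOdd n
... | true  | true  = λ ()
... | true  | false = λ ()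
... | false | true  = λ ()
... | false | false = λ ()
value-↝-≢ (recentre {suc s} {zero} _)     with isOdd s
... | true  = λ ()
... | false = λ ()
value-↝-≢ (recentre {s} {suc zero} _)     with isOdd s
... | true  = λ ()
... | false = λ ()
value-↝-≢ (recentre {s} {suc (suc n)} _)  with isOdd s | isOdd n
... | true  | true  = λ ()
... | true  | false = λ ()
... | false | true  = λ ()
... | false | false = λ ()

value-even : ∀ s n → isOdd s ≡ false → value s (suc n) ≡ 0
value-even s zero    even-s rewrite even-s = refl
value-even s (suc n) even-s rewrite even-s = refl

value-odd-zero : ∀ s → isOdd s ≡ true → value s 0 ≡ 1
value-odd-zero (suc s) odd-s with isOdd s
value-odd-zero (suc s) ()    | true
value-odd-zero (suc s) _     | false = refl

value-even-zero : ∀ s → isOdd s ≡ false → value (suc (suc s)) 0 ≡ 2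
value-even-zero s even-s rewrite even-s = refl

value-odd-one : ∀ s → isOdd s ≡ true → value s 1 ≡ 3
value-odd-one s odd-s rewrite odd-s = refl

value-odd-even : ∀ s n → isOdd s ≡ true → isOdd n ≡ false → value s (suc (suc n)) ≡ 1
value-odd-even s n odd-s even-n rewrite odd-s | even-n = refl

value-odd-odd : ∀ s n → isOdd s ≡ true → isOdd n ≡ true → value s (suc (suc n)) ≡ 2
value-odd-odd s n odd-s odd-n rewrite odd-s | odd-n = refl

value-mex : ∀ a k → k < uncurry value a → Σ (ℕ × ℕ) λ b → a ↝ b × uncurry value b ≡ k
value-mex (zero , zero) k ()
value-mex (zero , suc n) k k< = contradiction (subst (k <_) (value-even 0 n refl) k<) n≮0
value-mex (suc s , zero) zero _ = (0 , 0) , recentre (s≤s z≤n) , refl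
value-mex (suc s , zero) (suc k) k< with isOdd s in odd-s | k<
value-mex (suc s , zero) (suc k) k< | true  | s≤s (s≤s z≤n) = (s , 0) , resolve , value-odd-zero s odd-s
value-mex (suc s , zero) (suc k) k< | false | s≤s ()
value-mex (suc s , suc zero) k k< with isOdd s in odd-s | k<
value-mex (suc s , suc zero) k k< | true | ()
value-mex (suc s , suc zero) 0 k< | false | _ = (s , 1) , resolve , value-even s 0 odd-s
value-mex (suc s , suc zero) 1 k< | false | _ = (1 , 0) , recentre (s≤s z≤n) , refl
value-mex (suc s , suc zero) 2 k< | false | _ = (suc (suc s) , 0) , break , value-even-zero s odd-s
value-mex (suc s , suc zero) (suc (suc (suc k))) k< | false | s≤s (s≤s (s≤s ()))
value-mex (suc s , suc (suc n)) k k< with isOdd s in odd-s | isOdd n in odd-n | k<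
value-mex (suc s , suc (suc n)) k k< | true | _ | ()
value-mex (suc s , suc (suc n)) 0 k< | false | _ | _ =
  (s , suc (suc n)) , resolve , value-even s (suc n) odd-s
value-mex (suc s , suc (suc n)) 1 k< | false | true | _ =
  (suc (suc n) , 0) , recentre (s≤s z≤n) , value-odd-zero (suc (suc n)) (cong (not ∘ not) odd-n)
value-mex (suc s , suc (suc n)) (suc (suc k)) k< | false | true | s≤s (s≤s ())
value-mex (suc s , suc (suc n)) (suc k) k< | false | false | s≤s ()

↝-by-resolve : ∀ {s n s′ n′} → s ≡ suc s′ → n′ ≡ n → (s , n) ↝ (s′ , n′)
↝-by-resolve refl refl = resolve

↝-by-break : ∀ {s n s′ n′} → s′ ≡ suc s → n ≡ suc n′ → (s , n) ↝ (s′ , n′)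
↝-by-break refl refl = break

↝-by-recentre : ∀ {s n t} → 0 < s + n → t ≡ (n , 0) → (s , n) ↝ t
↝-by-recentre pos refl = recentre pos

bit : Bool → ℕ
bit false = 0
bit true  = 1

bit-injective : ∀ {a b} → bit a ≡ bit b → a ≡ b
bit-injective {false} {false} _ = refl
bit-injective {true}  {true}  _ = refl
bit-injective {false} {true}  ()
bit-injective {true}  {false} ()

xor-cancelˡ : ∀ a {b c} → a xor b ≡ a xor c → b ≡ c
xor-cancelˡ false e = e
xor-cancelˡ true  e = not-injective e

count : ∀ {k} → (Fin k → Bool) → ℕ
count {zero}  f = 0
count {suc k} f = bit (f zero) + count (f ∘ suc)

count-cong : ∀ {k} {f g : Fin k → Bool} → (∀ i → f i ≡ g i) → count f ≡ count g
count-cong {zero}  _   = refl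
count-cong {suc k} f≗g = cong₂ _+_ (cong bit (f≗g zero)) (count-cong (f≗g ∘ suc))

count-all : ∀ {k} {f : Fin k → Bool} → (∀ i → f i ≡ true) → count f ≡ k
count-all {zero}  _   = refl
count-all {suc k} all rewrite all zero = cong suc (count-all (all ∘ suc))

count-none : ∀ {k} {f : Fin k → Bool} → (∀ i → f i ≡ false) → count f ≡ 0
count-none {zero}  _    = refl
count-none {suc k} none rewrite none zero = count-none (none ∘ suc)

count-positive : ∀ {k} {f : Fin k → Bool} i → f i ≡ true → 0 < count f
count-positive         zero    fi rewrite fi = s≤s z≤n
count-positive {f = f} (suc i) fi = ≤-trans (count-positive i fi) (m≤n+m _ (bit (f zero)))

count-witness : ∀ {k m} (f : Fin k → Bool) → count f ≡ suc m → Σ (Fin k) λ i → f i ≡ true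
count-witness {suc k} f c with f zero in f0
... | true  = zero , f0
... | false = let i , fi = count-witness (f ∘ suc) c in suc i , fi

count-remove : ∀ {k} {f g : Fin k → Bool} j → f j ≡ true → g j ≡ false →
               (∀ i → i ≢ j → f i ≡ g i) → count f ≡ suc (count g)
count-remove zero fj gj rest rewrite fj | gj = cong suc (count-cong (λ i → rest (suc i) λ ()))
count-remove {g = g} (suc j) fj gj rest rewrite rest zero (λ ()) =
  trans (cong (bit (g zero) +_) (count-remove j fj gj (λ i i≢j → rest (suc i) (i≢j ∘ Fin.suc-injective))))
        (+-suc _ _)

except-at : ∀ {k} {A : Set} {f g : Fin k → A} j →
            f j ≡ g j → (∀ i → i ≢ j → f i ≡ g i) → ∀ i → f i ≡ g i
except-at j fj rest i with i Fin.≟ j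
... | yes refl = fj
... | no  i≢j  = rest i i≢j

data Piece : Set where
  pu pw px : Piece

_≟ᴾ_ : DecidableEquality Piece
pu ≟ᴾ pu = yes refl
pw ≟ᴾ pw = yes refl
px ≟ᴾ px = yes refl
pu ≟ᴾ pw = no λ ()
pu ≟ᴾ px = no λ ()
pw ≟ᴾ pu = no λ ()
pw ≟ᴾ px = no λ ()
px ≟ᴾ pu = no λ ()
px ≟ᴾ pw = no λ ()

data Place : Set where
  centre : Place
  at     : Piece → Place

isCentre : Place → Bool
isCentre centre = true
isCentre (at _) = false

isAt : Piece → Place → Bool
isAt h centre = false
isAt h (at g) = does (g ≟ᴾ h)

record Gadget : Set where
  constructor ⟨_,_,_⟩
  field
    u w x : Bool

⟨⟩-cong : ∀ {a a′ b b′ c c′} →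
          a ≡ a′ → b ≡ b′ → c ≡ c′ → ⟨ a , b , c ⟩ ≡ ⟨ a′ , b′ , c′ ⟩
⟨⟩-cong refl refl refl = refl

every-gadget : {P : Gadget → Set} →
  P ⟨ false , false , false ⟩ → P ⟨ false , false , true ⟩ →
  P ⟨ false , true  , false ⟩ → P ⟨ false , true  , true ⟩ →
  P ⟨ true  , false , false ⟩ → P ⟨ true  , false , true ⟩ →
  P ⟨ true  , true  , false ⟩ → P ⟨ true  , true  , true ⟩ →
  ∀ γ → P γ
every-gadget fff _ _ _ _ _ _ _ ⟨ false , false , false ⟩ = fff
every-gadget _ fft _ _ _ _ _ _ ⟨ false , false , true  ⟩ = fft
every-gadget _ _ ftf _ _ _ _ _ ⟨ false , true  , false ⟩ = ftf
every-gadget _ _ _ ftt _ _ _ _ ⟨ false , true  , true  ⟩ = ftt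
every-gadget _ _ _ _ tff _ _ _ ⟨ true  , false , false ⟩ = tff
every-gadget _ _ _ _ _ tft _ _ ⟨ true  , false , true  ⟩ = tft
every-gadget _ _ _ _ _ _ ttf _ ⟨ true  , true  , false ⟩ = ttf
every-gadget _ _ _ _ _ _ _ ttt ⟨ true  , true  , true  ⟩ = ttt

marked : Piece → Gadget → Bool
marked pu = Gadget.u
marked pw = Gadget.w
marked px = Gadget.x

-- The component of a vertex of a gadget: the centre's, or the one represented
-- by the given piece (x when x belongs to it).
place : Piece → Gadget → Place
place pu ⟨ a , _ , c ⟩ = if a then (if c then at px else at pu) else centre
place pw ⟨ _ , b , c ⟩ = if b then (if c then at px else at pw) else centre
place px ⟨ a , b , c ⟩ = if c ∨ (a ∧ b) then at px else centre

data Class : Set where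
  absorbed single fresh : Class

class : Gadget → Class
class ⟨ false , false , false ⟩ = absorbed
class ⟨ true  , true  , false ⟩ = fresh
class _                         = single

advance : Class → Class
advance fresh = single
advance _     = absorbed

isSingle isFresh : Class → Bool
isSingle single = true
isSingle _      = false
isFresh  fresh  = true
isFresh  _      = false

single-live : ∀ {c} → c ≡ single → c ≢ absorbed
single-live refl ()

fresh-live : ∀ {c} → c ≡ fresh → c ≢ absorbed
fresh-live refl ()

isSingle-true : ∀ {c} → isSingle c ≡ true → c ≡ single
isSingle-true {single} _ = refl

isFresh-true : ∀ {c} → isFresh c ≡ true → c ≡ fresh
isFresh-true {fresh} _ = refl

isSingle-advance : ∀ c → isSingle (advance c) ≡ isFresh c
isSingle-advance absorbed = refl
isSingle-advance single   = refl
isSingle-advance fresh    = refl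

isFresh-advance : ∀ c → isFresh (advance c) ≡ false
isFresh-advance absorbed = refl
isFresh-advance single   = refl
isFresh-advance fresh    = refl

toggle : (Piece → Bool) → Gadget → Gadget
toggle m ⟨ a , b , c ⟩ = ⟨ m pu xor a , m pw xor b , m px xor c ⟩

toggle-cong : ∀ {m m′} γ → (∀ g → m g ≡ m′ g) → toggle m γ ≡ toggle m′ γ
toggle-cong ⟨ a , b , c ⟩ m≗m′ =
  ⟨⟩-cong (cong (_xor a) (m≗m′ pu)) (cong (_xor b) (m≗m′ pw)) (cong (_xor c) (m≗m′ px))

place-u-x : ∀ γ → Gadget.u γ ≡ Gadget.x γ → place pu γ ≡ place px γ
place-u-x = every-gadget (λ _ → refl) (λ ()) (λ _ → refl) (λ ()) (λ ()) (λ _ → refl) (λ ()) (λ _ → refl)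

place-w-x : ∀ γ → Gadget.w γ ≡ Gadget.x γ → place pw γ ≡ place px γ
place-w-x = every-gadget (λ _ → refl) (λ ()) (λ ()) (λ _ → refl) (λ _ → refl) (λ ()) (λ ()) (λ _ → refl)

place-u-centre : ∀ γ → Gadget.u γ ≡ false → place pu γ ≡ centre
place-u-centre ⟨ _ , _ , _ ⟩ refl = refl

place-w-centre : ∀ γ → Gadget.w γ ≡ false → place pw γ ≡ centre
place-w-centre ⟨ _ , _ , _ ⟩ refl = refl

place-marked : ∀ g γ → marked g γ ≡ true → Σ Piece λ h → place g γ ≡ at h
place-marked pu ⟨ true , _ , false ⟩ _ = pu , refl
place-marked pu ⟨ true , _ , true  ⟩ _ = px , refl
place-marked pw ⟨ _ , true , false ⟩ _ = pw , refl
place-marked pw ⟨ _ , true , true  ⟩ _ = px , refl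
place-marked px ⟨ _ , _ , true     ⟩ _ = px , refl
place-marked pu ⟨ false , _ , _ ⟩ ()
place-marked pw ⟨ _ , false , _ ⟩ ()
place-marked px ⟨ _ , _ , false ⟩ ()

class-after-centre-flip : ∀ γ → class (toggle (λ g → not (isCentre (place g γ))) γ) ≡ advance (class γ)
class-after-centre-flip = every-gadget refl refl refl refl refl refl refl refl

class-after-piece-flip : ∀ g γ {h} → place g γ ≡ at h →
  let γ′ = toggle (λ g′ → isAt h (place g′ γ)) γ in
  (class γ ≡ single × class γ′ ≡ absorbed) ⊎ (class γ ≡ fresh × class γ′ ≡ single)
class-after-piece-flip pu = every-gadget
  (λ ()) (λ ())
  (λ ()) (λ ())
  (λ { refl → inj₁ (refl , refl) }) (λ { refl → inj₁ (refl , refl) })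
  (λ { refl → inj₂ (refl , refl) }) (λ { refl → inj₁ (refl , refl) })
class-after-piece-flip pw = every-gadget
  (λ ()) (λ ())
  (λ { refl → inj₁ (refl , refl) }) (λ { refl → inj₁ (refl , refl) })
  (λ ()) (λ ())
  (λ { refl → inj₂ (refl , refl) }) (λ { refl → inj₁ (refl , refl) })
class-after-piece-flip px = every-gadget
  (λ ()) (λ { refl → inj₁ (refl , refl) })
  (λ ()) (λ { refl → inj₁ (refl , refl) })
  (λ ()) (λ { refl → inj₁ (refl , refl) })
  (λ { refl → inj₂ (refl , refl) }) (λ { refl → inj₁ (refl , refl) })

module FlagColoringT (p d : ℕ) where
  open FlagColoring (TV p d) TAdj

  adj-sym : ∀ {a b : TV p d} → TAdj a b → TAdj b a
  adj-sym (v-pend j) = pend-v j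
  adj-sym (pend-v j) = v-pend j
  adj-sym (u-x i)    = x-u i
  adj-sym (x-u i)    = u-x i
  adj-sym (w-x i)    = x-w i
  adj-sym (x-w i)    = w-x i
  adj-sym (u-v i)    = v-u i
  adj-sym (v-u i)    = u-v i
  adj-sym (w-v i)    = v-w i
  adj-sym (v-w i)    = w-v i

  Bicolouring : Set
  Bicolouring = TV p d → Bool

  Represents : Bicolouring → Coloring → Set
  Represents β col = ∀ w → col w ≡ bit (β w)

  differs : Bicolouring → TV p d → Bool
  differs β w = β cv xor β w

  same-colour : ∀ β {w y} → differs β w ≡ differs β y → β w ≡ β y
  same-colour β = xor-cancelˡ (β cv)

  centre-coloured : ∀ β {w} → differs β w ≡ false → β w ≡ β cv
  centre-coloured β e = same-colour β (trans e (sym (xor-same (β cv))))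

  colours-differ : ∀ β {w y} → differs β w ≡ false → differs β y ≡ true → β w ≢ β y
  colours-differ β dw dy e with () ← trans (sym dw) (trans (cong (β cv xor_) e) dy)

  gadget : Bicolouring → Fin d → Gadget
  gadget β i = ⟨ differs β (uu i) , differs β (ww i) , differs β (xx i) ⟩

  vertex : Fin d → Piece → TV p d
  vertex i pu = uu i
  vertex i pw = ww i
  vertex i px = xx i

  differs-vertex : ∀ β i g → differs β (vertex i g) ≡ marked g (gadget β i)
  differs-vertex β i pu = refl
  differs-vertex β i pw = refl
  differs-vertex β i px = refl

  data Component : Set where
    centre  : Component
    pendant : Fin p → Component
    piece   : Fin d → Piece → Component

  _≟ᶜ_ : DecidableEquality Component
  centre    ≟ᶜ centre      = yes refl
  pendant j ≟ᶜ pendant j′  = map′ (cong pendant) (λ { refl → refl }) (j Fin.≟ j′)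
  piece i g ≟ᶜ piece i′ g′ =
    map′ (uncurry (cong₂ piece)) (λ { refl → refl , refl }) ((i Fin.≟ i′) ×-dec (g ≟ᴾ g′))
  centre    ≟ᶜ pendant _   = no λ ()
  centre    ≟ᶜ piece _ _   = no λ ()
  pendant _ ≟ᶜ centre      = no λ ()
  pendant _ ≟ᶜ piece _ _   = no λ ()
  piece _ _ ≟ᶜ centre      = no λ ()
  piece _ _ ≟ᶜ pendant _   = no λ ()

  inGadget : Fin d → Place → Component
  inGadget i centre = centre
  inGadget i (at g) = piece i g

  component : Bicolouring → TV p d → Component
  component β cv       = centre
  component β (pend j) = if differs β (pend j) then pendant j else centre
  component β (uu i)   = inGadget i (place pu (gadget β i))
  component β (ww i)   = inGadget i (place pw (gadget β i))
  component β (xx i)   = inGadget i (place px (gadget β i))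

  component-vertex : ∀ β i g → component β (vertex i g) ≡ inGadget i (place g (gadget β i))
  component-vertex β i pu = refl
  component-vertex β i pw = refl
  component-vertex β i px = refl

  component-pendant : ∀ β {j} → differs β (pend j) ≡ true → component β (pend j) ≡ pendant j
  component-pendant β dj rewrite dj = refl

  representative : Component → TV p d
  representative centre      = cv
  representative (pendant j) = pend j
  representative (piece i g) = vertex i g

  recolour : Bicolouring → Component → Bicolouring
  recolour β K w = does (component β w ≟ᶜ K) xor β w

  recolour-inside : ∀ β {K w} → component β w ≡ K → recolour β K w ≡ not (β w)
  recolour-inside β {K} {w} e rewrite dec-true (component β w ≟ᶜ K) e = refl

  recolour-outside : ∀ β {K w} → component β w ≢ K → recolour β K w ≡ β w
  recolour-outside β {K} {w} ne rewrite dec-false (component β w ≟ᶜ K) ne = refl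

  component-edge : ∀ β {w y} → TAdj w y → β w ≡ β y → component β w ≡ component β y
  component-edge β (v-pend j) e rewrite sym e | xor-same (β cv) = refl
  component-edge β (u-x i)    e = cong (inGadget i) (place-u-x (gadget β i) (cong (β cv xor_) e))
  component-edge β (w-x i)    e = cong (inGadget i) (place-w-x (gadget β i) (cong (β cv xor_) e))
  component-edge β (u-v i)    e =
    cong (inGadget i) (place-u-centre (gadget β i) (trans (cong (β cv xor_) e) (xor-same (β cv))))
  component-edge β (w-v i)    e =
    cong (inGadget i) (place-w-centre (gadget β i) (trans (cong (β cv xor_) e) (xor-same (β cv))))
  component-edge β (pend-v j) e = sym (component-edge β (v-pend j) (sym e))
  component-edge β (x-u i)    e = sym (component-edge β (u-x i) (sym e))
  component-edge β (x-w i)    e = sym (component-edge β (w-x i) (sym e))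
  component-edge β (v-u i)    e = sym (component-edge β (u-v i) (sym e))
  component-edge β (v-w i)    e = sym (component-edge β (w-v i) (sym e))

  module _ {β : Bicolouring} {col : Coloring} (rep : Represents β col) where

    colour-≡ : ∀ {w y} → β w ≡ β y → col w ≡ col y
    colour-≡ {w} {y} e = trans (rep w) (trans (cong bit e) (sym (rep y)))

    colour-≡⁻¹ : ∀ {w y} → col w ≡ col y → β w ≡ β y
    colour-≡⁻¹ {w} {y} e = bit-injective (trans (sym (rep w)) (trans e (rep y)))

    reach⇒same-component : ∀ {v w} → MonoReach col v w → component β w ≡ component β v
    reach⇒same-component here         = refl
    reach⇒same-component (step r a e) =
      trans (sym (component-edge β a (colour-≡⁻¹ (trans (monoReach-colour r) (sym e)))))
            (reach⇒same-component r)

    reach-from-representative : ∀ w → MonoReach col (representative (component β w)) w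
    reach-from-representative cv = here
    reach-from-representative (pend j) with differs β (pend j) in dp
    ... | true  = here
    ... | false = step here (v-pend j) (colour-≡ (centre-coloured β dp))
    reach-from-representative (uu i) with differs β (uu i) in du | differs β (xx i) in dx
    ... | false | _     = step here (v-u i) (colour-≡ (centre-coloured β du))
    ... | true  | true  = step here (x-u i) (colour-≡ (same-colour β (trans du (sym dx))))
    ... | true  | false = here
    reach-from-representative (ww i) with differs β (ww i) in dw | differs β (xx i) in dx
    ... | false | _     = step here (v-w i) (colour-≡ (centre-coloured β dw))
    ... | true  | true  = step here (x-w i) (colour-≡ (same-colour β (trans dw (sym dx))))
    ... | true  | false = here
    reach-from-representative (xx i)
      with differs β (xx i) in dx | differs β (uu i) in du | differs β (ww i) in dw
    ... | true  | _     | _     = here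
    ... | false | true  | true  = here
    ... | false | false | _     =
      step (step here (v-u i) (colour-≡ (centre-coloured β du))) (u-x i) (colour-≡ (centre-coloured β dx))
    ... | false | true  | false =
      step (step here (v-w i) (colour-≡ (centre-coloured β dw))) (w-x i) (colour-≡ (centre-coloured β dx))

    same-component⇒reach : ∀ {v w} → component β w ≡ component β v → MonoReach col v w
    same-component⇒reach {v} {w} same =
      monoReach-trans (monoReach-sym adj-sym (reach-from-representative v))
                      (subst (λ K → MonoReach col (representative K) w) same (reach-from-representative w))

    recolour-move : ∀ {v u} → TAdj v u → β u ≢ β v → Move col (bit ∘ recolour β (component β v))
    recolour-move {v} {u} a β-ne = v , u , a , β-ne ∘ colour-≡⁻¹ , λ w → inside w , outside w
      where
      inside : ∀ w → MonoReach col v w → bit (recolour β (component β v) w) ≡ col u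
      inside w r = begin
        bit (recolour β (component β v) w) ≡⟨ cong bit (recolour-inside β (reach⇒same-component r)) ⟩
        bit (not (β w))                    ≡⟨ cong (bit ∘ not) (colour-≡⁻¹ (monoReach-colour r)) ⟩
        bit (not (β v))                    ≡⟨ cong bit (sym (¬-not β-ne)) ⟩
        bit (β u)                          ≡⟨ sym (rep u) ⟩
        col u                              ∎
      outside : ∀ w → ¬ MonoReach col v w → bit (recolour β (component β v) w) ≡ col w
      outside w unreached =
        trans (cong bit (recolour-outside β (unreached ∘ same-component⇒reach))) (sym (rep w))

    move-recolours : ∀ {col′} (m : Move col col′) → Represents (recolour β (component β (proj₁ m))) col′
    move-recolours {col′} (v , u , a , col-ne , moved) w with component β w ≟ᶜ component β v
    ... | yes same = begin
      col′ w          ≡⟨ proj₁ (moved w) (same-component⇒reach same) ⟩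
      col u           ≡⟨ rep u ⟩
      bit (β u)       ≡⟨ cong bit (¬-not (col-ne ∘ colour-≡)) ⟩
      bit (not (β v)) ≡⟨ cong (bit ∘ not) (colour-≡⁻¹ (monoReach-colour (same-component⇒reach same))) ⟨
      bit (not (β w)) ∎
    ... | no differ = trans (proj₂ (moved w) (differ ∘ reach⇒same-component)) (rep w)

  nSingle nFresh : Bicolouring → ℕ
  nSingle β = count (λ j → differs β (pend j)) + count (λ i → isSingle (class (gadget β i)))
  nFresh  β = count (λ i → isFresh (class (gadget β i)))

  counts : Bicolouring → ℕ × ℕ
  counts β = nSingle β , nFresh β

  counts-cong : ∀ {β β′} → (∀ w → β w ≡ β′ w) → counts β ≡ counts β′
  counts-cong {β} {β′} β≗β′ =
    cong₂ _,_ (cong₂ _+_ (count-cong (differs≗ ∘ pend))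
                         (count-cong (cong (isSingle ∘ class) ∘ gadget≗)))
              (count-cong (cong (isFresh ∘ class) ∘ gadget≗))
    where
    differs≗ : ∀ w → differs β w ≡ differs β′ w
    differs≗ w = cong₂ _xor_ (β≗β′ cv) (β≗β′ w)
    gadget≗ : ∀ i → gadget β i ≡ gadget β′ i
    gadget≗ i = ⟨⟩-cong (differs≗ (uu i)) (differs≗ (ww i)) (differs≗ (xx i))

  differs-recolour : ∀ β K w →
    differs (recolour β K) w ≡ (does (centre ≟ᶜ K) xor does (component β w ≟ᶜ K)) xor differs β w
  differs-recolour β K w = interchange (does (centre ≟ᶜ K)) (β cv) (does (component β w ≟ᶜ K)) (β w)

  gadget-recolour : ∀ β K i → gadget (recolour β K) i ≡
    toggle (λ g → does (centre ≟ᶜ K) xor does (inGadget i (place g (gadget β i)) ≟ᶜ K)) (gadget β i)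
  gadget-recolour β K i =
    ⟨⟩-cong (differs-recolour β K (uu i)) (differs-recolour β K (ww i)) (differs-recolour β K (xx i))

  inGadget-centre : ∀ i P → does (inGadget i P ≟ᶜ centre) ≡ isCentre P
  inGadget-centre i centre = refl
  inGadget-centre i (at g) = refl

  inGadget-pendant : ∀ i P j → does (inGadget i P ≟ᶜ pendant j) ≡ false
  inGadget-pendant i centre j = refl
  inGadget-pendant i (at g) j = refl

  inGadget-piece : ∀ i P h → does (inGadget i P ≟ᶜ piece i h) ≡ isAt h P
  inGadget-piece i centre h = refl
  inGadget-piece i (at g) h rewrite dec-true (i Fin.≟ i) refl = refl

  inGadget-other-piece : ∀ {i i′} P h → i′ ≢ i → does (inGadget i′ P ≟ᶜ piece i h) ≡ false
  inGadget-other-piece         centre h _    = refl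
  inGadget-other-piece {i} {i′} (at g) h i′≢i rewrite dec-false (i′ Fin.≟ i) i′≢i = refl

  class-recentred : ∀ β i → class (gadget (recolour β centre) i) ≡ advance (class (gadget β i))
  class-recentred β i = begin
    class (gadget (recolour β centre) i)
      ≡⟨ cong class (gadget-recolour β centre i) ⟩
    class (toggle (λ g → not (does (inGadget i (place g (gadget β i)) ≟ᶜ centre))) (gadget β i))
      ≡⟨ cong class (toggle-cong (gadget β i) (λ g → cong not (inGadget-centre i (place g (gadget β i))))) ⟩
    class (toggle (λ g → not (isCentre (place g (gadget β i)))) (gadget β i))
      ≡⟨ class-after-centre-flip (gadget β i) ⟩
    advance (class (gadget β i)) ∎

  gadget-after-pendant : ∀ β j i → gadget (recolour β (pendant j)) i ≡ gadget β i
  gadget-after-pendant β j i =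
    trans (gadget-recolour β (pendant j) i)
          (toggle-cong (gadget β i) (λ g → inGadget-pendant i (place g (gadget β i)) j))

  gadget-after-piece : ∀ β i h →
    gadget (recolour β (piece i h)) i ≡ toggle (λ g → isAt h (place g (gadget β i))) (gadget β i)
  gadget-after-piece β i h =
    trans (gadget-recolour β (piece i h) i)
          (toggle-cong (gadget β i) (λ g → inGadget-piece i (place g (gadget β i)) h))

  gadget-after-other-piece : ∀ β {i i′} h → i′ ≢ i →
                             gadget (recolour β (piece i h)) i′ ≡ gadget β i′
  gadget-after-other-piece β {i′ = i′} h i′≢i =
    trans (gadget-recolour β (piece _ h) i′)
          (toggle-cong (gadget β i′) (λ g → inGadget-other-piece (place g (gadget β i′)) h i′≢i))

  pendant-recentred : ∀ β j → differs (recolour β centre) (pend j) ≡ false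
  pendant-recentred β j rewrite differs-recolour β centre (pend j) with differs β (pend j)
  ... | true  = refl
  ... | false = refl

  pendant-resolved : ∀ β {j} → differs β (pend j) ≡ true →
                     differs (recolour β (pendant j)) (pend j) ≡ false
  pendant-resolved β {j} dj
    rewrite differs-recolour β (pendant j) (pend j) | dj | dec-true (j Fin.≟ j) refl = refl

  pendant-after-pendant : ∀ β {j} j′ → j′ ≢ j →
                          differs (recolour β (pendant j)) (pend j′) ≡ differs β (pend j′)
  pendant-after-pendant β {j} j′ j′≢j
    rewrite differs-recolour β (pendant j) (pend j′) with differs β (pend j′)
  ... | true  rewrite dec-false (j′ Fin.≟ j) j′≢j = refl
  ... | false = refl

  pendant-after-piece : ∀ β i h j → differs (recolour β (piece i h)) (pend j) ≡ differs β (pend j)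
  pendant-after-piece β i h j rewrite differs-recolour β (piece i h) (pend j) with differs β (pend j)
  ... | true  = refl
  ... | false = refl

  recentre-counts : ∀ β → counts (recolour β centre) ≡ (nFresh β , 0)
  recentre-counts β =
    cong₂ _,_ (cong₂ _+_ (count-none (pendant-recentred β))
                         (count-cong λ i → trans (cong isSingle (class-recentred β i)) (isSingle-advance _)))
              (count-none λ i → trans (cong isFresh (class-recentred β i)) (isFresh-advance _))

  pendant-counts : ∀ β {j} → differs β (pend j) ≡ true →
    let β′ = recolour β (pendant j) in nSingle β ≡ suc (nSingle β′) × nFresh β′ ≡ nFresh β
  pendant-counts β {j} dj =
    cong₂ _+_ (count-remove j dj (pendant-resolved β dj)
                            (λ j′ j′≢j → sym (pendant-after-pendant β j′ j′≢j)))
              (count-cong λ i → cong (isSingle ∘ class) (sym (gadget-after-pendant β j i))) ,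
    count-cong λ i → cong (isFresh ∘ class) (gadget-after-pendant β j i)

  data PieceRecoloured (β β′ : Bicolouring) (i : Fin d) : Set where
    resolved : class (gadget β i) ≡ single →
               nSingle β ≡ suc (nSingle β′) → nFresh β′ ≡ nFresh β → PieceRecoloured β β′ i
    broken   : class (gadget β i) ≡ fresh →
               nSingle β′ ≡ suc (nSingle β) → nFresh β ≡ suc (nFresh β′) → PieceRecoloured β β′ i

  piece-counts : ∀ β i g {h} → place g (gadget β i) ≡ at h → PieceRecoloured β (recolour β (piece i h)) i
  piece-counts β i g {h} pg = by-class (class-after-piece-flip g (gadget β i) pg)
    where
    β′ : Bicolouring
    β′ = recolour β (piece i h)
    γ′ : Gadget
    γ′ = toggle (λ g′ → isAt h (place g′ (gadget β i))) (gadget β i)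

    class-here : ∀ {c} → class γ′ ≡ c → class (gadget β′ i) ≡ c
    class-here = trans (cong class (gadget-after-piece β i h))

    class-elsewhere : ∀ {i′} → i′ ≢ i → class (gadget β′ i′) ≡ class (gadget β i′)
    class-elsewhere i′≢i = cong class (gadget-after-other-piece β h i′≢i)

    pendants-same : count (λ j → differs β (pend j)) ≡ count (λ j → differs β′ (pend j))
    pendants-same = count-cong λ j → sym (pendant-after-piece β i h j)

    by-class : (class (gadget β i) ≡ single × class γ′ ≡ absorbed) ⊎
               (class (gadget β i) ≡ fresh × class γ′ ≡ single) → PieceRecoloured β β′ i
    by-class (inj₁ (was-single , now-absorbed)) =
      resolved was-single
        (trans (cong₂ _+_ pendants-same
                          (count-remove i (cong isSingle was-single) (cong isSingle (class-here now-absorbed))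
                                        (λ i′ i′≢i → cong isSingle (sym (class-elsewhere i′≢i)))))
               (+-suc _ _))
        (count-cong (except-at i (trans (cong isFresh (class-here now-absorbed)) (cong isFresh (sym was-single)))
                                 (λ i′ i′≢i → cong isFresh (class-elsewhere i′≢i))))
    by-class (inj₂ (was-fresh , now-single)) =
      broken was-fresh
        (trans (cong₂ _+_ (sym pendants-same)
                          (count-remove i (cong isSingle (class-here now-single)) (cong isSingle was-fresh)
                                        (λ i′ i′≢i → cong isSingle (class-elsewhere i′≢i))))
               (+-suc _ _))
        (count-remove i (cong isFresh was-fresh) (cong isFresh (class-here now-single))
                      (λ i′ i′≢i → cong isFresh (sym (class-elsewhere i′≢i))))

  recentre-↝ : ∀ β → 0 < nSingle β + nFresh β → counts β ↝ counts (recolour β centre)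
  recentre-↝ β pos = ↝-by-recentre pos (recentre-counts β)

  piece-↝ : ∀ {β β′ i} → PieceRecoloured β β′ i → counts β ↝ counts β′
  piece-↝ (resolved _ s n) = ↝-by-resolve s n
  piece-↝ (broken _ s n)   = ↝-by-break s n

  gadget-↝ : ∀ β i g → 0 < nSingle β + nFresh β →
             counts β ↝ counts (recolour β (inGadget i (place g (gadget β i))))
  gadget-↝ β i g pos with place g (gadget β i) in pg
  ... | centre = recentre-↝ β pos
  ... | at h   = piece-↝ (piece-counts β i g pg)

  recolour-↝ : ∀ β v → 0 < nSingle β + nFresh β → counts β ↝ counts (recolour β (component β v))
  recolour-↝ β cv       pos = recentre-↝ β pos
  recolour-↝ β (pend j) pos with differs β (pend j) in dj
  ... | true  = let s , n = pendant-counts β dj in ↝-by-resolve s n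
  ... | false = recentre-↝ β pos
  recolour-↝ β (uu i)   pos = gadget-↝ β i pu pos
  recolour-↝ β (ww i)   pos = gadget-↝ β i pw pos
  recolour-↝ β (xx i)   pos = gadget-↝ β i px pos

  gadget-positive : ∀ β i g → marked g (gadget β i) ≡ true → 0 < nSingle β + nFresh β
  gadget-positive β i g mg with place-marked g (gadget β i) mg
  ... | h , pg with class-after-piece-flip g (gadget β i) pg
  ...   | inj₁ (was-single , _) =
    ≤-trans (count-positive i (cong isSingle was-single))
            (≤-trans (m≤n+m _ (count (λ j → differs β (pend j)))) (m≤m+n (nSingle β) (nFresh β)))
  ...   | inj₂ (was-fresh , _) =
    ≤-trans (count-positive i (cong isFresh was-fresh)) (m≤n+m (nFresh β) (nSingle β))

  marked-positive : ∀ β w → differs β w ≡ true → 0 < nSingle β + nFresh β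
  marked-positive β cv       dw = contradiction (trans (sym (xor-same (β cv))) dw) λ ()
  marked-positive β (pend j) dw =
    ≤-trans (count-positive j dw) (≤-trans (m≤m+n _ _) (m≤m+n (nSingle β) (nFresh β)))
  marked-positive β (uu i)   dw = gadget-positive β i pu dw
  marked-positive β (ww i)   dw = gadget-positive β i pw dw
  marked-positive β (xx i)   dw = gadget-positive β i px dw

  moved-positive : ∀ β {u v} → β u ≢ β v → 0 < nSingle β + nFresh β
  moved-positive β {u} {v} β-ne with differs β u in du | differs β v in dv
  ... | true  | _     = marked-positive β u du
  ... | false | true  = marked-positive β v dv
  ... | false | false = contradiction (trans (centre-coloured β du) (sym (centre-coloured β dv))) β-ne

  HasOption : Bicolouring → (Bicolouring → Set) → Set
  HasOption β P =
    Σ (TV p d) λ v → Σ (TV p d) λ u → TAdj v u × β u ≢ β v × P (recolour β (component β v))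

  boundary : ∀ β i → class (gadget β i) ≢ absorbed →
    Σ Piece λ g → Σ (TV p d) λ w →
      TAdj (vertex i g) w × marked g (gadget β i) ≡ true × differs β w ≡ false × component β w ≡ centre
  boundary β i live with differs β (uu i) in du | differs β (ww i) | differs β (xx i)
  ... | true  | _     | _     = pu , cv   , u-v i , refl , xor-same (β cv) , refl
  ... | false | true  | _     = pw , cv   , w-v i , refl , xor-same (β cv) , refl
  ... | false | false | true  = px , uu i , x-u i , refl , du , cong (inGadget i) (place-u-centre (gadget β i) du)
  ... | false | false | false = ⊥-elim (live refl)

  piece-option : ∀ β i → class (gadget β i) ≢ absorbed →
                 HasOption β (λ β′ → PieceRecoloured β β′ i)
  piece-option β i live with boundary β i live
  ... | g , w , a , mg , dw , _ with place-marked g (gadget β i) mg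
  ...   | h , pg =
    vertex i g , w , a , colours-differ β dw (trans (differs-vertex β i g) mg) ,
    subst (λ K → PieceRecoloured β (recolour β K) i)
          (sym (trans (component-vertex β i g) (cong (inGadget i) pg)))
          (piece-counts β i g pg)

  some-single : ∀ β {s} → nSingle β ≡ suc s →
    (Σ (Fin p) λ j → differs β (pend j) ≡ true) ⊎ (Σ (Fin d) λ i → class (gadget β i) ≡ single)
  some-single β es with count (λ j → differs β (pend j)) in ep | es
  ... | suc _ | _   = inj₁ (count-witness _ ep)
  ... | zero  | es′ = let i , si = count-witness _ es′ in inj₂ (i , isSingle-true si)

  some-fresh : ∀ β {n} → nFresh β ≡ suc n → Σ (Fin d) λ i → class (gadget β i) ≡ fresh
  some-fresh β ef = let i , fi = count-witness _ ef in i , isFresh-true fi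

  some-live : ∀ β → 0 < nSingle β + nFresh β →
    (Σ (Fin p) λ j → differs β (pend j) ≡ true) ⊎ (Σ (Fin d) λ i → class (gadget β i) ≢ absorbed)
  some-live β pos with nSingle β in es | nFresh β in ef | pos
  ... | suc _ | _     | _ with some-single β es
  ...   | inj₁ marked-pendant = inj₁ marked-pendant
  ...   | inj₂ (i , si)       = inj₂ (i , single-live si)
  some-live β pos | zero | suc _ | _ = let i , fi = some-fresh β ef in inj₂ (i , fresh-live fi)

  resolve-option : ∀ β {s n} → nSingle β ≡ suc s → nFresh β ≡ n →
                   HasOption β (λ β′ → counts β′ ≡ (s , n))
  resolve-option β es ef with some-single β es
  ... | inj₁ (j , dj) =
    pend j , cv , pend-v j , colours-differ β (xor-same (β cv)) dj ,
    subst (λ K → counts (recolour β K) ≡ _) (sym (component-pendant β dj))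
          (let s′ , n′ = pendant-counts β dj in cong₂ _,_ (suc-injective (trans (sym s′) es)) (trans n′ ef))
  ... | inj₂ (i , si) with piece-option β i (single-live si)
  ...   | v , u , a , β-ne , resolved _ s′ n′ =
    v , u , a , β-ne , cong₂ _,_ (suc-injective (trans (sym s′) es)) (trans n′ ef)
  ...   | _ , _ , _ , _ , broken sf _ _ = contradiction (trans (sym si) sf) λ ()

  break-option : ∀ β {s n} → nSingle β ≡ s → nFresh β ≡ suc n →
                 HasOption β (λ β′ → counts β′ ≡ (suc s , n))
  break-option β es ef with some-fresh β ef
  ... | i , fi with piece-option β i (fresh-live fi)
  ...   | v , u , a , β-ne , broken _ s′ n′ =
    v , u , a , β-ne , cong₂ _,_ (trans s′ (cong suc es)) (suc-injective (trans (sym n′) ef))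
  ...   | _ , _ , _ , _ , resolved ss _ _ = contradiction (trans (sym fi) ss) λ ()

  recentre-option : ∀ β {s n} → nSingle β ≡ s → nFresh β ≡ n → 0 < s + n →
                    HasOption β (λ β′ → counts β′ ≡ (n , 0))
  recentre-option β es ef pos with some-live β (subst (0 <_) (sym (cong₂ _+_ es ef)) pos)
  ... | inj₁ (j , dj) = cv , pend j , v-pend j , (colours-differ β (xor-same (β cv)) dj) ∘ sym ,
    trans (recentre-counts β) (cong (_, 0) ef)
  ... | inj₂ (i , live) with boundary β i live
  ...   | g , w , a , mg , dw , cw =
    w , vertex i g , adj-sym a , (colours-differ β dw (trans (differs-vertex β i g) mg)) ∘ sym ,
    subst (λ K → counts (recolour β K) ≡ _) (sym cw) (trans (recentre-counts β) (cong (_, 0) ef))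

  realise : ∀ β {t} → counts β ↝ t → HasOption β (λ β′ → counts β′ ≡ t)
  realise β s↝t with nSingle β in es | nFresh β in ef | s↝t
  ... | _ | _ | resolve      = resolve-option β es ef
  ... | _ | _ | break        = break-option β es ef
  ... | _ | _ | recentre pos = recentre-option β es ef pos

  Abstracts : ℕ × ℕ → Coloring → Set
  Abstracts t col = Σ Bicolouring λ β → Represents β col × counts β ≡ t

  abstracts-unique : ∀ {s t col} → Abstracts s col → Abstracts t col → s ≡ t
  abstracts-unique (β , rep , refl) (β′ , rep′ , refl) =
    counts-cong λ w → bit-injective (trans (sym (rep w)) (rep′ w))

  forth : ∀ {s col col′} → Abstracts s col → Move col col′ →
          Σ (ℕ × ℕ) λ t → s ↝ t × Abstracts t col′
  forth (β , rep , refl) m@(v , _ , _ , col-ne , _) =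
    _ , recolour-↝ β v (moved-positive β (col-ne ∘ colour-≡ rep)) , _ , move-recolours rep m , refl

  back : ∀ {s t col} → Abstracts s col → s ↝ t →
         Σ Coloring λ col′ → Move col col′ × Abstracts t col′
  back (β , rep , refl) s↝t with realise β s↝t
  ... | v , u , a , β-ne , counted = _ , recolour-move rep a β-ne , _ , (λ _ → refl) , counted

  initial : Bicolouring
  initial cv       = false
  initial (pend _) = true
  initial (uu _)   = true
  initial (ww _)   = true
  initial (xx _)   = false

  initial-abstracts : Abstracts (p , d) (Tcol p d)
  initial-abstracts = initial , represents , cong₂ _,_ singles (count-all λ _ → refl)
    where
    represents : Represents initial (Tcol p d)
    represents cv       = refl
    represents (pend _) = refl
    represents (uu _)   = refl
    represents (ww _)   = refl
    represents (xx _)   = refl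
    singles : nSingle initial ≡ p
    singles = trans (cong₂ _+_ (count-all λ _ → refl)
                               (count-none {f = isSingle ∘ class ∘ gadget initial} λ _ → refl))
                    (+-identityʳ p)

  value-is-grundy : TGrundy p d (value p d)
  value-is-grundy =
    Simulation.grundy-of-abstraction _↝_ (uncurry value) weight ↝-weight value-↝-≢ value-mex
                                     Abstracts abstracts-unique forth back initial-abstracts

isOdd-even : ∀ k → isOdd (2 * k) ≡ false
isOdd-even zero    = refl
isOdd-even (suc k) = trans (cong isOdd (*-suc 2 k)) (cong (not ∘ not) (isOdd-even k))

isOdd-odd : ∀ k → isOdd (2 * k + 1) ≡ true
isOdd-odd k rewrite +-comm (2 * k) 1 | isOdd-even k = refl

value-no-pendants : ∀ d → value 0 d ≡ 0
value-no-pendants zero    = refl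
value-no-pendants (suc d) = value-even 0 d refl

value-odd-no-triples : ∀ k → value (2 * k + 1) 0 ≡ 1
value-odd-no-triples k = value-odd-zero (2 * k + 1) (isOdd-odd k)

value-even-no-triples : ∀ k → value (2 * suc k) 0 ≡ 2
value-even-no-triples k =
  subst (λ s → value s 0 ≡ 2) (sym (*-suc 2 k)) (value-even-zero (2 * k) (isOdd-even k))

value-even-triples : ∀ k e → value (2 * suc k) (suc e) ≡ 0
value-even-triples k e = value-even (2 * suc k) e (isOdd-even (suc k))

value-odd-one-triple : ∀ k → value (2 * k + 1) 1 ≡ 3
value-odd-one-triple k = value-odd-one (2 * k + 1) (isOdd-odd k)

value-odd-even-triples : ∀ k e → value (2 * k + 1) (2 * suc e) ≡ 1
value-odd-even-triples k e =
  subst (λ n → value (2 * k + 1) n ≡ 1) (sym (*-suc 2 e))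
        (value-odd-even (2 * k + 1) (2 * e) (isOdd-odd k) (isOdd-even e))

value-odd-odd-triples : ∀ k e → value (2 * k + 1) (2 * suc e + 1) ≡ 2
value-odd-odd-triples k e =
  subst (λ n → value (2 * k + 1) (n + 1) ≡ 2) (sym (*-suc 2 e))
        (value-odd-odd (2 * k + 1) (2 * e + 1) (isOdd-odd k) (isOdd-odd e))

T-grundy : ∀ p d {n} → value p d ≡ n → TGrundy p d n
T-grundy p d refl = FlagColoringT.value-is-grundy p d

theorem2 :
    -- (i) p = 0, any d
    (∀ d → TGrundy 0 d 0) ×
    -- (ii) d = 0: p odd gives *1, p ≥ 2 even gives *2
    (∀ k → TGrundy (2 * k + 1) 0 1) ×
    (∀ k → TGrundy (2 * suc k) 0 2) ×
    -- (iii) p ≥ 2 even, d ≥ 1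
    (∀ k e → TGrundy (2 * suc k) (suc e) 0) ×
    -- (iv) p odd: d = 1 gives *3, d ≥ 2 even gives *1, d ≥ 3 odd gives *2
    (∀ k → TGrundy (2 * k + 1) 1 3) ×
    (∀ k e → TGrundy (2 * k + 1) (2 * suc e) 1) ×
    (∀ k e → TGrundy (2 * k + 1) (2 * suc e + 1) 2)
theorem2 =
  (λ d → T-grundy _ _ (value-no-pendants d)) ,
  (λ k → T-grundy _ _ (value-odd-no-triples k)) ,
  (λ k → T-grundy _ _ (value-even-no-triples k)) ,
  (λ k e → T-grundy _ _ (value-even-triples k e)) ,
  (λ k → T-grundy _ _ (value-odd-one-triple k)) ,
  (λ k e → T-grundy _ _ (value-odd-even-triples k e)) ,
  (λ k e → T-grundy _ _ (value-odd-odd-triples k e))
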